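{- For every positive integer $k$, $b_2(T_k) \geq \log_3(4)\cdot k$.
   Context: For a finite simple graph $G=(V,E)$, a biclique on a subset of $V$ is given by two disjoint sets $X,Y\subseteq V$; its edges are all pairs $\{x,y\}$ with $x\in X$, $y\in Y$. An odd cover of $G$ is a collection of bicliques on subsets of $V$ such that every pair of vertices adjacent in $G$ is an edge of an odd number of the bicliques, and every pair of distinct non-adjacent vertices is an edge of an even number of the bicliques. $b_2(G)$ denotes the minimum cardinality of an odd cover of $G$. The graph $T_k$ has as vertex set all strings of length $k$ over the alphabet $\{0,1,2,\varepsilon\}$, and two strings $u,v$ are adjacent iff the number of positions $i$ such that $u_i\neq v_i$ and neither $u_i$ nor $v_i$ equals $\varepsilon$ is odd. -}

module Defs where

open import Data.Bool using (Bool; true; false; _∧_; _∨_; if_then_else_)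
open import Data.Nat using (ℕ; zero; suc; _+_; _%_)
open import Data.Vec using (Vec; []; _∷_)
open import Data.List using (List; []; _∷_)
open import Data.Product using (_×_)
open import Relation.Binary.PropositionalEquality using (_≡_)
open import Relation.Nullary using (¬_)

data Sym : Set where
  s0 s1 s2 ε : Sym

-- vertices of T_k: strings of length k over Sym
V : ℕ → Set
V k = Vec Sym k

differ : Sym → Sym → Bool
differ ε _  = false
differ _ ε  = false
differ s0 s0 = false
differ s1 s1 = false
differ s2 s2 = false
differ _ _  = true

diffCount : ∀ {k} → V k → V k → ℕ
diffCount [] [] = 0
diffCount (a ∷ u) (b ∷ v) = (if differ a b then 1 else 0) + diffCount u v

Adjacent : ∀ {k} → V k → V k → Set
Adjacent u v = diffCount u v % 2 ≡ 1

record Biclique (k : ℕ) : Set where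
  field
    X Y      : V k → Bool
    disjoint : ∀ v → ¬ (X v ≡ true × Y v ≡ true)

open Biclique public

hasEdge : ∀ {k} → Biclique k → V k → V k → Bool
hasEdge B u v = (X B u ∧ Y B v) ∨ (X B v ∧ Y B u)

edgeCount : ∀ {k} → List (Biclique k) → V k → V k → ℕ
edgeCount [] u v = 0
edgeCount (B ∷ Bs) u v = (if hasEdge B u v then 1 else 0) + edgeCount Bs u v

-- odd cover of T_k: for distinct u,v, the edge count is odd iff u,v adjacent,
-- i.e. edge count ≡ diffCount (mod 2)
IsOddCover : ∀ {k} → List (Biclique k) → Set
IsOddCover {k} Bs = ∀ (u v : V k) → ¬ (u ≡ v) → edgeCount Bs u v % 2 ≡ diffCount u v % 2

-- Give every vertex v a signature in {X, Y, neither}^m recording on which side of each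
-- of the m bicliques it lies. The number of bicliques containing an edge {v, w} is
-- determined by the signatures of v and w, so in an odd cover vertices with equal
-- signatures are adjacent to exactly the same vertices. In T_k the adjacency pattern
-- determines a vertex (probe it with the strings c ε…ε and ε w), so the signature map
-- is injective on the 4^k vertices and 4^k ≤ 3^m.
module Submission where

open import Defs
open import Data.Nat using (ℕ; suc; _≤_; _^_)
open import Data.List using (List; length)

open import Data.Nat using (zero; _+_; _%_)
open import Data.Nat.Properties using (+-identityʳ)
open import Data.Bool using (Bool; true; false; _∧_; _∨_; if_then_else_)
open import Data.Vec using (Vec; []; _∷_; lookup; tabulate; replicate)
open import Data.Vec.Properties using (lookup∘tabulate; tabulate∘lookup; tabulate-cong; ∷-injective)
open import Data.List using ([]; _∷_)
open import Data.Fin using (Fin; zero; suc; combine; funToFin; finToFun)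
open import Data.Fin.Properties using (funToFin-finToFin; finToFun-funToFin; injective⇒≤; inj⇒≟)
open import Data.Product using (_×_; _,_)
open import Data.Empty using (⊥-elim)
open import Function using (_∘_; _↔_; _↣_; mk↔ₛ′; mk↣; Injection; Inverse; Injective)
open import Function.Construct.Composition using (_↣-∘_)
open import Function.Construct.Identity using (↔-id)
open import Function.Properties.Inverse using (↔⇒↣; ↔-sym)
open import Relation.Nullary using (¬_; yes; no)
open import Relation.Binary.PropositionalEquality

funToFin-cong : ∀ {m n} {f g : Fin m → Fin n} → f ≗ g → funToFin f ≡ funToFin g
funToFin-cong {zero}  f≗g = refl
funToFin-cong {suc m} f≗g = cong₂ combine (f≗g zero) (funToFin-cong (f≗g ∘ suc))

Vec↔Fin^ : ∀ {A : Set} {a k} → A ↔ Fin a → Vec A k ↔ Fin (a ^ k)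
Vec↔Fin^ {A} {a} {k} A↔Fin = mk↔ₛ′ encode decode encode∘decode decode∘encode
  where
  open Inverse A↔Fin using (to; from; strictlyInverseˡ; strictlyInverseʳ)

  -- finToFun and funToFin fixed at exponent k, which Agda cannot infer from a ^ k.
  digits : Fin (a ^ k) → Fin k → Fin a
  digits = finToFun

  number : (Fin k → Fin a) → Fin (a ^ k)
  number = funToFin

  encode : Vec A k → Fin (a ^ k)
  encode xs = number (to ∘ lookup xs)

  decode : Fin (a ^ k) → Vec A k
  decode i = tabulate (from ∘ digits i)

  encode∘decode : ∀ i → encode (decode i) ≡ i
  encode∘decode i = begin
    number (to ∘ lookup (tabulate (from ∘ digits i)))
      ≡⟨ funToFin-cong (λ j → cong to (lookup∘tabulate (from ∘ digits i) j)) ⟩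
    number (to ∘ from ∘ digits i)
      ≡⟨ funToFin-cong (strictlyInverseˡ ∘ digits i) ⟩
    number (digits i)
      ≡⟨ funToFin-finToFin {k} i ⟩
    i ∎
    where open ≡-Reasoning

  decode∘encode : ∀ xs → decode (encode xs) ≡ xs
  decode∘encode xs = begin
    tabulate (from ∘ digits (number (to ∘ lookup xs)))
      ≡⟨ tabulate-cong (λ j → cong from (finToFun-funToFin (to ∘ lookup xs) j)) ⟩
    tabulate (from ∘ to ∘ lookup xs)
      ≡⟨ tabulate-cong (strictlyInverseʳ ∘ lookup xs) ⟩
    tabulate (lookup xs)
      ≡⟨ tabulate∘lookup xs ⟩
    xs ∎
    where open ≡-Reasoning

↣⇒≤ : ∀ {A B : Set} {a b} → A ↔ Fin a → B ↔ Fin b → A ↣ B → a ≤ b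
↣⇒≤ A↔Fin B↔Fin A↣B =
  injective⇒≤ (Injection.injective (↔⇒↣ B↔Fin ↣-∘ (A↣B ↣-∘ ↔⇒↣ (↔-sym A↔Fin))))

Sym↔Fin4 : Sym ↔ Fin 4
Sym↔Fin4 = mk↔ₛ′ toFin fromFin toFin∘fromFin fromFin∘toFin
  where
  toFin : Sym → Fin 4
  toFin s0 = zero
  toFin s1 = suc zero
  toFin s2 = suc (suc zero)
  toFin ε  = suc (suc (suc zero))

  fromFin : Fin 4 → Sym
  fromFin zero = s0
  fromFin (suc zero) = s1
  fromFin (suc (suc zero)) = s2
  fromFin (suc (suc (suc zero))) = ε

  toFin∘fromFin : ∀ i → toFin (fromFin i) ≡ i
  toFin∘fromFin zero = refl
  toFin∘fromFin (suc zero) = refl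
  toFin∘fromFin (suc (suc zero)) = refl
  toFin∘fromFin (suc (suc (suc zero))) = refl

  fromFin∘toFin : ∀ a → fromFin (toFin a) ≡ a
  fromFin∘toFin s0 = refl
  fromFin∘toFin s1 = refl
  fromFin∘toFin s2 = refl
  fromFin∘toFin ε  = refl

V↔Fin : ∀ k → V k ↔ Fin (4 ^ k)
V↔Fin k = Vec↔Fin^ Sym↔Fin4

indicator : Bool → ℕ
indicator b = if b then 1 else 0

indicator-parity-injective : ∀ b b' → indicator b % 2 ≡ indicator b' % 2 → b ≡ b'
indicator-parity-injective true  true  _ = refl
indicator-parity-injective false false _ = refl
indicator-parity-injective true  false ()
indicator-parity-injective false true  ()

sideCode : Bool → Bool → Fin 3
sideCode true  _     = zero
sideCode false true  = suc zero
sideCode false false = suc (suc zero)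

sideDecode : Fin 3 → Bool × Bool
sideDecode zero             = true , false
sideDecode (suc zero)       = false , true
sideDecode (suc (suc zero)) = false , false

sideDecode∘sideCode : ∀ x y → ¬ (x ≡ true × y ≡ true) → sideDecode (sideCode x y) ≡ (x , y)
sideDecode∘sideCode true  true  disj = ⊥-elim (disj (refl , refl))
sideDecode∘sideCode true  false _    = refl
sideDecode∘sideCode false true  _    = refl
sideDecode∘sideCode false false _    = refl

side : ∀ {k} → Biclique k → V k → Fin 3
side B v = sideCode (X B v) (Y B v)

side-injective : ∀ {k} (B : Biclique k) {u v} → side B u ≡ side B v → (X B u , Y B u) ≡ (X B v , Y B v)
side-injective B {u} {v} eq = begin
  (X B u , Y B u)           ≡⟨ sideDecode∘sideCode (X B u) (Y B u) (disjoint B u) ⟨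
  sideDecode (side B u)     ≡⟨ cong sideDecode eq ⟩
  sideDecode (side B v)     ≡⟨ sideDecode∘sideCode (X B v) (Y B v) (disjoint B v) ⟩
  (X B v , Y B v)           ∎
  where open ≡-Reasoning

hasEdge-cong-side : ∀ {k} (B : Biclique k) {u u'} → side B u ≡ side B u' → ∀ w → hasEdge B u w ≡ hasEdge B u' w
hasEdge-cong-side B eq w = cong (λ { (x , y) → (x ∧ Y B w) ∨ (X B w ∧ y) }) (side-injective B eq)

signature : ∀ {k} (Bs : List (Biclique k)) → V k → Vec (Fin 3) (length Bs)
signature []       v = []
signature (B ∷ Bs) v = side B v ∷ signature Bs v

edgeCount-cong-signature : ∀ {k} (Bs : List (Biclique k)) {u u'} → signature Bs u ≡ signature Bs u' →
                           ∀ w → edgeCount Bs u w ≡ edgeCount Bs u' w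
edgeCount-cong-signature []       _  w = refl
edgeCount-cong-signature (B ∷ Bs) eq w with ∷-injective eq
... | sameSide , sameRest =
  cong₂ _+_ (cong indicator (hasEdge-cong-side B sameSide w)) (edgeCount-cong-signature Bs sameRest w)

hasEdge-diagonal : ∀ {k} (B : Biclique k) v → hasEdge B v v ≡ false
hasEdge-diagonal B v with X B v | Y B v | disjoint B v
... | true  | true  | disj = ⊥-elim (disj (refl , refl))
... | true  | false | _    = refl
... | false | _     | _    = refl

edgeCount-diagonal : ∀ {k} (Bs : List (Biclique k)) v → edgeCount Bs v v ≡ 0
edgeCount-diagonal []       v = refl
edgeCount-diagonal (B ∷ Bs) v rewrite hasEdge-diagonal B v = edgeCount-diagonal Bs v

differ-diagonal : ∀ a → differ a a ≡ false
differ-diagonal s0 = refl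
differ-diagonal s1 = refl
differ-diagonal s2 = refl
differ-diagonal ε  = refl

diffCount-diagonal : ∀ {k} (v : V k) → diffCount v v ≡ 0
diffCount-diagonal []      = refl
diffCount-diagonal (a ∷ v) rewrite differ-diagonal a = diffCount-diagonal v

oddCover-parity : ∀ {k} (Bs : List (Biclique k)) → IsOddCover Bs →
                  ∀ u w → edgeCount Bs u w % 2 ≡ diffCount u w % 2
oddCover-parity {k} Bs cover u w with inj⇒≟ (↔⇒↣ (V↔Fin k)) u w
... | no  u≢w  = cover u w u≢w
... | yes refl rewrite edgeCount-diagonal Bs u | diffCount-diagonal u = refl

differ-ε : ∀ a → differ a ε ≡ false
differ-ε s0 = refl
differ-ε s1 = refl
differ-ε s2 = refl
differ-ε ε  = refl

diffCount-blank : ∀ {k} (v : V k) → diffCount v (replicate k ε) ≡ 0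
diffCount-blank []      = refl
diffCount-blank (a ∷ v) rewrite differ-ε a = diffCount-blank v

diffCount-probe-head : ∀ {k} a (v : V k) c → diffCount (a ∷ v) (c ∷ replicate k ε) ≡ indicator (differ a c)
diffCount-probe-head a v c rewrite diffCount-blank v = +-identityʳ (indicator (differ a c))

diffCount-probe-tail : ∀ {k} a (v w : V k) → diffCount (a ∷ v) (ε ∷ w) ≡ diffCount v w
diffCount-probe-tail a v w rewrite differ-ε a = refl

letter-determined-by-differ : ∀ a a' → differ a s0 ≡ differ a' s0 → differ a s1 ≡ differ a' s1 → a ≡ a'
letter-determined-by-differ s0 s0 _  _  = refl
letter-determined-by-differ s1 s1 _  _  = refl
letter-determined-by-differ s2 s2 _  _  = refl
letter-determined-by-differ ε  ε  _  _  = refl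
letter-determined-by-differ s0 s1 () _
letter-determined-by-differ s0 s2 () _
letter-determined-by-differ s0 ε  _  ()
letter-determined-by-differ s1 s0 () _
letter-determined-by-differ s1 s2 _  ()
letter-determined-by-differ s1 ε  () _
letter-determined-by-differ s2 s0 () _
letter-determined-by-differ s2 s1 _  ()
letter-determined-by-differ s2 ε  () _
letter-determined-by-differ ε  s0 _  ()
letter-determined-by-differ ε  s1 () _
letter-determined-by-differ ε  s2 () _

adjacency-determines-vertex : ∀ {k} (u u' : V k) → (∀ w → diffCount u w % 2 ≡ diffCount u' w % 2) → u ≡ u'
adjacency-determines-vertex []       []         _    = refl
adjacency-determines-vertex {suc k} (a ∷ u) (a' ∷ u') same = cong₂ _∷_ sameHead sameTail
  where
  open ≡-Reasoning

  sameDiffer : ∀ c → differ a c ≡ differ a' c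
  sameDiffer c = indicator-parity-injective (differ a c) (differ a' c) (begin
    indicator (differ a c) % 2             ≡⟨ cong (_% 2) (diffCount-probe-head a u c) ⟨
    diffCount (a ∷ u) (c ∷ replicate k ε) % 2   ≡⟨ same (c ∷ replicate k ε) ⟩
    diffCount (a' ∷ u') (c ∷ replicate k ε) % 2 ≡⟨ cong (_% 2) (diffCount-probe-head a' u' c) ⟩
    indicator (differ a' c) % 2            ∎)

  sameHead : a ≡ a'
  sameHead = letter-determined-by-differ a a' (sameDiffer s0) (sameDiffer s1)

  sameTail : u ≡ u'
  sameTail = adjacency-determines-vertex u u' λ w → begin
    diffCount u w % 2           ≡⟨ cong (_% 2) (diffCount-probe-tail a u w) ⟨
    diffCount (a ∷ u) (ε ∷ w) % 2   ≡⟨ same (ε ∷ w) ⟩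
    diffCount (a' ∷ u') (ε ∷ w) % 2 ≡⟨ cong (_% 2) (diffCount-probe-tail a' u' w) ⟩
    diffCount u' w % 2          ∎

oddCover-signature-injective : ∀ {k} (Bs : List (Biclique k)) → IsOddCover Bs →
                               Injective _≡_ _≡_ (signature Bs)
oddCover-signature-injective Bs cover {u} {u'} sameSignature =
  adjacency-determines-vertex u u' λ w → begin
    diffCount u w % 2   ≡⟨ oddCover-parity Bs cover u w ⟨
    edgeCount Bs u w % 2  ≡⟨ cong (_% 2) (edgeCount-cong-signature Bs sameSignature w) ⟩
    edgeCount Bs u' w % 2 ≡⟨ oddCover-parity Bs cover u' w ⟩
    diffCount u' w % 2  ∎
  where open ≡-Reasoning

proposition3p6 : (k : ℕ) → 1 ≤ k → (Bs : List (Biclique k)) → IsOddCover Bs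
                 → 4 ^ k ≤ 3 ^ length Bs
proposition3p6 k _ Bs cover =
  ↣⇒≤ (V↔Fin k) (Vec↔Fin^ (↔-id (Fin 3))) (mk↣ (oddCover-signature-injective Bs cover))
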